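{- Let $M$ be a permutation group on a finite set $\Omega$. Then $$|\mathcal{F}(M)|\leq \sum_{C\in\mathcal{C}(M)}2^{\mathrm{orb}_\Omega(C)}\leq \sum_{C\in\mathcal{C}(M)}2^{\frac{|\Omega|}{2}+\frac{\mathrm{fix}_\Omega(C)}{2}}.$$
   Context: $\mathcal{F}(M)=\{\Delta\subseteq\Omega : \Delta^g=\Delta \text{ for some } g\in M\setminus\{1\}\}$. $\mathcal{C}(M)$ is the set of subgroups of $M$ of prime order. For a cyclic group $C=\langle g\rangle$, $\mathrm{fix}_\Omega(C)$ is the number of points of $\Omega$ fixed by $g$ and $\mathrm{orb}_\Omega(C)$ is the number of cycles of $g$ (including fixed points). -}

module Defs where

open import Data.Nat using (ℕ; _+_; _*_; _∸_; _^_; _≤_)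
open import Data.Nat.Primality using (Prime)
open import Data.Nat.Properties using (_≤?_)
open import Data.Bool using (Bool; true; false)
open import Data.Fin using (Fin; toℕ)
open import Data.Fin.Properties using (_≟_)
open import Data.Fin.Subset using (Subset)
open import Data.Fin.Permutation
  using (Permutation′; _⟨$⟩ʳ_; _≈_; id; flip; _∘ₚ_)
open import Data.Vec using (lookup)
open import Data.List using (List; []; _∷_; length; filter; map; allFin)
open import Data.List.Relation.Unary.All using (All; all?)
open import Data.List.Relation.Unary.Any using (Any)
open import Data.List.Relation.Unary.AllPairs using (AllPairs)
open import Data.List.Relation.Unary.Unique.Propositional using (Unique)
open import Data.Product using (Σ; _×_)
open import Relation.Binary.PropositionalEquality using (_≡_)
open import Relation.Nullary using (¬_)
open import Function.Bundles using (_⇔_)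

-- Ω = Fin n ; Sym(Ω) = Permutation′ n ; equality of permutations is the
-- library's pointwise equality _≈_ .

Perm : ℕ → Set
Perm n = Permutation′ n

record IsPermGroup {n : ℕ} (M : Perm n → Set) : Set where
  field
    resp : ∀ {π σ} → π ≈ σ → M π → M σ
    id∈  : M id
    ∘∈   : ∀ {π σ} → M π → M σ → M (π ∘ₚ σ)
    ⁻¹∈  : ∀ {π} → M π → M (flip π)

Stabilises : {n : ℕ} → Perm n → Subset n → Set
Stabilises g Δ = ∀ i → lookup Δ (g ⟨$⟩ʳ i) ≡ lookup Δ i

InF : {n : ℕ} → (Perm n → Set) → Subset n → Set
InF {n} M Δ = Σ (Perm n) λ g → M g × ¬ (g ≈ id) × Stabilises g Δ

_∈ₚ_ : {n : ℕ} → Perm n → List (Perm n) → Set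
g ∈ₚ xs = Any (λ h → g ≈ h) xs

record PrimeSubgroup {n : ℕ} (M : Perm n → Set) : Set where
  field
    elems   : List (Perm n)
    distinct : AllPairs (λ a b → ¬ (a ≈ b)) elems
    prime   : Prime (length elems)
    ⊆M      : All M elems
    id∈     : id ∈ₚ elems
    ∘∈      : ∀ {π σ} → π ∈ₚ elems → σ ∈ₚ elems → (π ∘ₚ σ) ∈ₚ elems
    ⁻¹∈     : ∀ {π} → π ∈ₚ elems → flip π ∈ₚ elems

SameSubgroup : {n : ℕ} {M : Perm n → Set} → PrimeSubgroup M → PrimeSubgroup M → Set
SameSubgroup {n} C D = ∀ (g : Perm n) → (g ∈ₚ PrimeSubgroup.elems C) ⇔ (g ∈ₚ PrimeSubgroup.elems D)

fixC : {n : ℕ} {M : Perm n → Set} → PrimeSubgroup M → ℕ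
fixC {n} C = length (filter (λ i → all? (λ g → g ⟨$⟩ʳ i ≟ i) (PrimeSubgroup.elems C)) (allFin n))

-- orb_Ω(C): number of C-orbits on Ω (= cycles of a generator, including
-- fixed points), counted as the number of points that are the least
-- element (w.r.t. toℕ) of their orbit { g i | g ∈ C }.
orbC : {n : ℕ} {M : Perm n → Set} → PrimeSubgroup M → ℕ
orbC {n} C = length (filter (λ i → all? (λ g → toℕ i ≤? toℕ (g ⟨$⟩ʳ i)) (PrimeSubgroup.elems C)) (allFin n))

-- |𝓕(M)| ≤ X : every duplicate-free list of members of 𝓕(M) has length ≤ X
CardFLe : {n : ℕ} → (Perm n → Set) → ℕ → Set
CardFLe {n} M X = ∀ (Ds : List (Subset n)) → Unique Ds → All (InF M) Ds → length Ds ≤ X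

Enumerates𝓒 : {n : ℕ} (M : Perm n → Set) → List (PrimeSubgroup M) → Set
Enumerates𝓒 M Cs = AllPairs (λ C D → ¬ SameSubgroup C D) Cs
                 × (∀ (C : PrimeSubgroup M) → Any (SameSubgroup C) Cs)

-- Real-number comparison  A ≤ Σ_{k ∈ ks} (√2)^k  encoded over ℕ:
-- with B = Σ_{k even} 2^(k/2) and E = Σ_{k odd} 2^((k-1)/2) the right side
-- is B + E·√2, and A ≤ B + E√2  ⇔  (A ∸ B)^2 ≤ 2·E^2.

half : ℕ → ℕ
half 0 = 0
half 1 = 0
half (ℕ.suc (ℕ.suc k)) = ℕ.suc (half k)

isEven : ℕ → Bool
isEven 0 = true
isEven 1 = false
isEven (ℕ.suc (ℕ.suc k)) = isEven k

evenPart : List ℕ → ℕ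
evenPart [] = 0
evenPart (k ∷ ks) with isEven k
... | true  = 2 ^ half k + evenPart ks
... | false = evenPart ks

oddPart : List ℕ → ℕ
oddPart [] = 0
oddPart (k ∷ ks) with isEven k
... | true  = oddPart ks
... | false = 2 ^ half k + oddPart ks

_≤Σ√2^_ : ℕ → List ℕ → Set
A ≤Σ√2^ ks = (A ∸ evenPart ks) ^ 2 ≤ 2 * (oddPart ks ^ 2)

-- A set Δ ∈ 𝓕(M) is stabilised by some g ≠ 1 in M. As g^(|Ω|!) = 1, g has an order m > 1, and for a
-- prime p ∣ m the power g^(m/p) has order p, so it generates some C ∈ 𝓒(M), which also stabilises Δ.
-- Thus Δ is one of the 2^orb(C) unions of C-orbits, and summing over 𝓒(M) bounds |𝓕(M)|.
-- For the second inequality, the greatest point of a non-trivial C-orbit is not its least point, so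
-- the least points of the non-trivial orbits inject into the points that are not least in their
-- orbit: orb(C) − fix(C) ≤ |Ω| − orb(C). Hence 2^orb(C) ≤ 2^⌊(|Ω| + fix(C))/2⌋ ≤ (√2)^(|Ω| + fix(C)).

module Submission where

open import Defs
open import Data.Nat using (ℕ; _+_; _^_; _≤_)
open import Data.List using (List; map)
open import Data.Nat.ListAction using (sum)
open import Data.Product using (_×_)

open import Level using (Level; 0ℓ)
open import Algebra.Bundles using (Group)
open import Data.Nat
  using (zero; suc; _*_; _∸_; _<_; _%_; _/_; _!; NonZero; >-nonZero; >-nonZero⁻¹; z≤n; s≤s; z<s; s<s)
open import Data.Nat.Properties hiding (_≟_)
open import Algebra.Properties.CommutativeSemigroup +-commutativeSemigroup using (x∙yz≈y∙xz)
open import Data.Nat.Primality using (Prime; prime⇒nonZero)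
open import Data.Nat.Primality.Factorisation using (factorise)
open import Data.Nat.DivMod using (m≡m%n+[m/n]*n; m%n<n)
open import Data.Nat.Divisibility using (_∣_; divides; ∣-trans; m∣m*n; m≤n⇒m!∣n!)
open import Data.Bool using (true; false)
open import Data.Fin using (Fin; toℕ)
open import Data.Fin.Properties using (_≟_; all?; pigeonhole; toℕ≤pred[n]; toℕ-injective)
open import Data.Fin.Permutation using (_⟨$⟩ʳ_; _⟨$⟩ˡ_; _∘ₚ_; id; flip; inverseˡ; inverseʳ)
  renaming (_≈_ to _≈ₚ_)
open import Data.Fin.Subset using (Subset) renaming (⊥ to ∅)
open import Data.Vec using (lookup; tabulate; _[_]≔_)
open import Data.Vec.Properties
  using (lookup∘updateAt; lookup∘updateAt′; tabulate-cong; tabulate∘lookup)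
open import Data.List using ([]; _∷_; [_]; _++_; length; filter; concatMap; applyUpTo; allFin)
open import Data.List.Properties
  using (length-map; length-++; length-removeAt′; length-applyUpTo; length-tabulate; map-cong; map-∘)
open import Data.List.Membership.Propositional using (_∈_; find)
open import Data.List.Membership.Propositional.Properties
  using (∈-map⁺; ∈-++⁺ˡ; ∈-++⁺ʳ; ∈-filter⁺; ∈-filter⁻; ∈-allFin; ∈-concat⁺′)
open import Data.List.Extrema.Nat
  using (argmin; argmax; argmin-sel; argmax-sel; f[argmin]≤f[xs]; f[xs]≤f[argmax])
open import Data.List.Relation.Unary.All as All using (All)
import Data.List.Relation.Unary.All.Properties as Allₚ
open import Data.List.Relation.Unary.Any as Any using (here; there; index; _─_; tail)
import Data.List.Relation.Unary.Any.Properties as Anyₚ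
open import Data.List.Relation.Unary.Unique.Propositional using (Unique; _∷_)
import Data.List.Relation.Unary.Unique.Propositional.Properties as Uniqueₚ
open import Data.Sum using (_⊎_; inj₁; inj₂)
open import Data.Product using (Σ-syntax; ∃-syntax; ∃₂; _,_; proj₂)
open import Relation.Nullary using (¬_; Dec; yes; no; contradiction)
open import Relation.Nullary.Decidable using (_×-dec_)
open import Relation.Unary using (Pred; Decidable)
open import Relation.Unary.Properties using (∁?)
open import Relation.Binary.PropositionalEquality
  using (_≡_; _≢_; refl; sym; trans; cong; cong₂; subst; module ≡-Reasoning)
open import Function using (_∘_)
open import Function.Bundles using (Equivalence)

private
  variable
    a b p : Level
    A : Set a
    B : Set b

least : {P : Pred ℕ p} → Decidable P → ∀ {n} → P n → ∃[ m ] P m × (∀ {j} → j < m → ¬ P j)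
least P? pn with P? 0
... | yes p0 = 0 , p0 , λ ()
least P? {zero}  pn | no ¬p0 = contradiction pn ¬p0
least P? {suc _} pn | no ¬p0 with m , pm , below ← least (P? ∘ suc) pn
  = suc m , pm , λ { {zero} _ → ¬p0 ; {suc _} (s<s j<m) → below j<m }

primeFactor : ∀ {m} → 1 < m → ∃₂ λ p q → Prime p × m ≡ p * q
primeFactor {m} 1<m with factorise m {{>-nonZero (<-trans z<s 1<m)}}
... | record { factors = [] ; isFactorisation = m≡1 } = contradiction m≡1 (>⇒≢ 1<m)
... | record { factors = p ∷ ps ; isFactorisation = m≡p*ps ; factorsPrime = prime-p All.∷ _ } =
  p , _ , prime-p , m≡p*ps

2*m≤n+o : ∀ {m n o l} → m ≤ o + l → m + l ≡ n → 2 * m ≤ n + o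
2*m≤n+o {m} {n} {o} {l} m≤o+l m+l≡n = begin
  m + (m + 0)   ≡⟨ cong (m +_) (+-identityʳ m) ⟩
  m + m         ≤⟨ +-monoʳ-≤ m m≤o+l ⟩
  m + (o + l)   ≡⟨ x∙yz≈y∙xz m o l ⟩
  o + (m + l)   ≡⟨ cong (o +_) m+l≡n ⟩
  o + n         ≡⟨ +-comm o n ⟩
  n + o         ∎
  where open ≤-Reasoning

∣n! : ∀ {d n} → 0 < d → d ≤ n → d ∣ n !
∣n! {suc d} _ d≤n = ∣-trans (m∣m*n (d !)) (m≤n⇒m!∣n! d≤n)

∈-─⁺ : ∀ {x y : A} {ys} (x∈ys : x ∈ ys) → y ∈ ys → y ≢ x → y ∈ (ys ─ x∈ys)
∈-─⁺ (here refl) (here refl) y≢x = contradiction refl y≢x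
∈-─⁺ (here refl) (there y∈ys) _  = y∈ys
∈-─⁺ (there _)   (here refl) _   = here refl
∈-─⁺ (there x∈ys) (there y∈ys) y≢x = there (∈-─⁺ x∈ys y∈ys y≢x)

length≤-injection : (f : A → B) {xs : List A} {ys : List B} → Unique xs →
                    (∀ {x y} → x ∈ xs → y ∈ xs → f x ≡ f y → x ≡ y) →
                    (∀ {x} → x ∈ xs → f x ∈ ys) → length xs ≤ length ys
length≤-injection f {[]} _ _ _ = z≤n
length≤-injection f {x ∷ xs} {ys} (x∉xs ∷ unique) injective into = begin
  suc (length xs)            ≤⟨ s≤s (length≤-injection f unique injective′ into′) ⟩
  suc (length (ys ─ fx∈ys))  ≡⟨ length-removeAt′ ys (index fx∈ys) ⟨
  length ys                  ∎
  where
  open ≤-Reasoning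
  fx∈ys : f x ∈ ys
  fx∈ys = into (here refl)
  injective′ : ∀ {y z} → y ∈ xs → z ∈ xs → f y ≡ f z → y ≡ z
  injective′ y∈xs z∈xs = injective (there y∈xs) (there z∈xs)
  into′ : ∀ {y} → y ∈ xs → f y ∈ (ys ─ fx∈ys)
  into′ y∈xs = ∈-─⁺ fx∈ys (into (there y∈xs))
    λ fy≡fx → All.lookup x∉xs y∈xs (injective (here refl) (there y∈xs) (sym fy≡fx))

length-filter+filter-∁ : {P : Pred A p} (P? : Decidable P) → ∀ xs →
                         length (filter P? xs) + length (filter (∁? P?) xs) ≡ length xs
length-filter+filter-∁ P? [] = refl
length-filter+filter-∁ P? (x ∷ xs) with P? x
... | yes _ = cong suc (length-filter+filter-∁ P? xs)
... | no _  = trans (+-suc _ _) (cong suc (length-filter+filter-∁ P? xs))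

length-concatMap : ∀ (f : A → List B) xs → length (concatMap f xs) ≡ sum (map (length ∘ f) xs)
length-concatMap f []       = refl
length-concatMap f (x ∷ xs) =
  trans (length-++ (f x)) (cong (length (f x) +_) (length-concatMap f xs))

sum-map-mono-≤ : ∀ {f g : A → ℕ} → (∀ x → f x ≤ g x) → ∀ xs → sum (map f xs) ≤ sum (map g xs)
sum-map-mono-≤ f≤g []       = z≤n
sum-map-mono-≤ f≤g (x ∷ xs) = +-mono-≤ (f≤g x) (sum-map-mono-≤ f≤g xs)

module _ {n : ℕ} where

  subsetsOf : List (Fin n) → List (Subset n)
  subsetsOf []       = [ ∅ ]
  subsetsOf (k ∷ ks) = map (_[ k ]≔ true) (subsetsOf ks) ++ map (_[ k ]≔ false) (subsetsOf ks)

  length-subsetsOf : ∀ ks → length (subsetsOf ks) ≡ 2 ^ length ks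
  length-subsetsOf []       = refl
  length-subsetsOf (k ∷ ks) = begin
    length (map (_[ k ]≔ true) Ss ++ map (_[ k ]≔ false) Ss)
      ≡⟨ length-++ (map (_[ k ]≔ true) Ss) ⟩
    length (map (_[ k ]≔ true) Ss) + length (map (_[ k ]≔ false) Ss)
      ≡⟨ cong₂ _+_ (length-map _ Ss) (length-map _ Ss) ⟩
    length Ss + length Ss
      ≡⟨ cong (λ l → l + l) (length-subsetsOf ks) ⟩
    2 ^ length ks + 2 ^ length ks
      ≡⟨ cong (2 ^ length ks +_) (+-identityʳ _) ⟨
    2 ^ suc (length ks)
      ∎
    where
    open ≡-Reasoning
    Ss : List (Subset n)
    Ss = subsetsOf ks

  restrictTo : List (Fin n) → Subset n → Subset n
  restrictTo []       Δ = ∅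
  restrictTo (k ∷ ks) Δ = restrictTo ks Δ [ k ]≔ lookup Δ k

  restrictTo∈subsetsOf : ∀ ks Δ → restrictTo ks Δ ∈ subsetsOf ks
  restrictTo∈subsetsOf []       Δ = here refl
  restrictTo∈subsetsOf (k ∷ ks) Δ with lookup Δ k
  ... | true  = ∈-++⁺ˡ (∈-map⁺ (_[ k ]≔ true) (restrictTo∈subsetsOf ks Δ))
  ... | false = ∈-++⁺ʳ _ (∈-map⁺ (_[ k ]≔ false) (restrictTo∈subsetsOf ks Δ))

  lookup-restrictTo : ∀ {ks k} Δ → k ∈ ks → lookup (restrictTo ks Δ) k ≡ lookup Δ k
  lookup-restrictTo {k′ ∷ ks} {k} Δ k∈ with k ≟ k′
  ... | yes refl = lookup∘updateAt k (restrictTo ks Δ)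
  ... | no k≢k′  =
    trans (lookup∘updateAt′ k k′ k≢k′ (restrictTo ks Δ)) (lookup-restrictTo Δ (tail k≢k′ k∈))

  preimage : (Fin n → Fin n) → Subset n → Subset n
  preimage r S = tabulate (lookup S ∘ r)

  ∈-preimages : ∀ {r ks Δ} → (∀ i → r i ∈ ks) → (∀ i → lookup Δ (r i) ≡ lookup Δ i) →
                Δ ∈ map (preimage r) (subsetsOf ks)
  ∈-preimages {r} {ks} {Δ} r∈ks Δ∘r≗Δ =
    subst (_∈ map (preimage r) (subsetsOf ks)) Δ-preimage
      (∈-map⁺ (preimage r) (restrictTo∈subsetsOf ks Δ))
    where
    Δ-preimage : preimage r (restrictTo ks Δ) ≡ Δ
    Δ-preimage = trans (tabulate-cong λ i → trans (lookup-restrictTo Δ (r∈ks i)) (Δ∘r≗Δ i))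
                       (tabulate∘lookup Δ)

-- Powers and orders in a group

module PowersInGroup {c ℓ} (G : Group c ℓ) where

  open Group G renaming (refl to ≈-refl; sym to ≈-sym; trans to ≈-trans)
  open import Algebra.Properties.Group G using (∙-cancelˡ; inverseʳ-unique)
  open import Algebra.Properties.Monoid.Mult monoid using (×-homo-+; ×-assocˡ) renaming (_×_ to _·_)
  open import Data.List.Membership.Setoid setoid using () renaming (_∈_ to _∈ᴳ_)
  open import Data.List.Relation.Unary.AllPairs using (AllPairs)
  import Data.List.Relation.Unary.AllPairs.Properties as AllPairsₚ
  open import Relation.Binary.Reasoning.Setoid setoid

  infixr 8 _^ᴳ_
  _^ᴳ_ : Carrier → ℕ → Carrier
  x ^ᴳ k = k · x

  ^ᴳ-homo-+ : ∀ x i j → x ^ᴳ (i + j) ≈ x ^ᴳ i ∙ x ^ᴳ j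
  ^ᴳ-homo-+ x i j = ×-homo-+ x i j

  ^ᴳ-^ᴳ : ∀ x q k → (x ^ᴳ q) ^ᴳ k ≈ x ^ᴳ (k * q)
  ^ᴳ-^ᴳ x q k = ×-assocˡ x k q

  ^ᴳ-multiple≈ε : ∀ {x m} → x ^ᴳ m ≈ ε → ∀ q → x ^ᴳ (q * m) ≈ ε
  ^ᴳ-multiple≈ε x^m≈ε zero    = ≈-refl
  ^ᴳ-multiple≈ε {x} {m} x^m≈ε (suc q) = begin
    x ^ᴳ (m + q * m)        ≈⟨ ^ᴳ-homo-+ x m (q * m) ⟩
    x ^ᴳ m ∙ x ^ᴳ (q * m)   ≈⟨ ∙-cong x^m≈ε (^ᴳ-multiple≈ε x^m≈ε q) ⟩
    ε ∙ ε                   ≈⟨ identityˡ ε ⟩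
    ε                       ∎

  record HasOrder (x : Carrier) (m : ℕ) : Set ℓ where
    field
      order>0  : 0 < m
      ^order≈ε : x ^ᴳ m ≈ ε
      ^j≉ε     : ∀ {j} → 0 < j → j < m → x ^ᴳ j ≉ ε

  order : (∀ y → Dec (y ≈ ε)) → ∀ {x K} → 0 < K → x ^ᴳ K ≈ ε → ∃[ m ] HasOrder x m
  order ≈ε? {x} K>0 x^K≈ε
    with m , (m>0 , x^m≈ε) , below ← least (λ j → 0 <? j ×-dec ≈ε? (x ^ᴳ j)) (K>0 , x^K≈ε) =
    m , record
      { order>0  = m>0
      ; ^order≈ε = x^m≈ε
      ; ^j≉ε     = λ j>0 j<m x^j≈ε → below j<m (j>0 , x^j≈ε)
      }

  ^ᴳ-hasOrder : ∀ {x p q} → HasOrder x (p * q) → 0 < p → HasOrder (x ^ᴳ q) p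
  ^ᴳ-hasOrder {x} {p} {q} ord p>0 = record
    { order>0  = p>0
    ; ^order≈ε = ≈-trans (^ᴳ-^ᴳ x q p) ^order≈ε
    ; ^j≉ε     = λ {j} j>0 j<p x^qj≈ε →
        ^j≉ε (*-monoˡ-< q j>0) (*-monoˡ-< q j<p) (≈-trans (≈-sym (^ᴳ-^ᴳ x q j)) x^qj≈ε)
    }
    where
    open HasOrder ord
    instance
      q≢0 : NonZero q
      q≢0 = m*n≢0⇒n≢0 p {{>-nonZero order>0}}

  order>1 : ∀ {x m} → HasOrder x m → x ≉ ε → 1 < m
  order>1 {x} ord x≉ε = ≤∧≢⇒< order>0 λ { refl → x≉ε (≈-trans (≈-sym (identityʳ x)) ^order≈ε) }
    where open HasOrder ord

  primeOrderPower : ∀ {x m} → HasOrder x m → x ≉ ε → ∃₂ λ p q → Prime p × HasOrder (x ^ᴳ q) p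
  primeOrderPower {x} ord x≉ε with p , q , prime-p , m≡p*q ← primeFactor (order>1 ord x≉ε) =
    p , q , prime-p ,
    ^ᴳ-hasOrder (subst (HasOrder x) m≡p*q ord) (>-nonZero⁻¹ p {{prime⇒nonZero prime-p}})

  powers : Carrier → ℕ → List Carrier
  powers h m = applyUpTo (h ^ᴳ_) m

  module _ {h m} (ord : HasOrder h m) where

    open HasOrder ord
    private instance
      m≢0 : NonZero m
      m≢0 = >-nonZero order>0

    ^ᴳ-%-order : ∀ k → h ^ᴳ k ≈ h ^ᴳ (k % m)
    ^ᴳ-%-order k = begin
      h ^ᴳ k                            ≡⟨ cong (h ^ᴳ_) (m≡m%n+[m/n]*n k m) ⟩
      h ^ᴳ (k % m + k / m * m)          ≈⟨ ^ᴳ-homo-+ h (k % m) (k / m * m) ⟩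
      h ^ᴳ (k % m) ∙ h ^ᴳ (k / m * m)   ≈⟨ ∙-congˡ (^ᴳ-multiple≈ε ^order≈ε (k / m)) ⟩
      h ^ᴳ (k % m) ∙ ε                  ≈⟨ identityʳ _ ⟩
      h ^ᴳ (k % m)                      ∎

    powers-distinct : AllPairs _≉_ (powers h m)
    powers-distinct = AllPairsₚ.applyUpTo⁺₁ (h ^ᴳ_) m λ {i} {j} i<j j<m h^i≈h^j →
      ^j≉ε (m<n⇒0<n∸m i<j) (≤-<-trans (m∸n≤m j i) j<m) (≈-sym (∙-cancelˡ (h ^ᴳ i) _ _ (begin
        h ^ᴳ i ∙ ε                  ≈⟨ identityʳ _ ⟩
        h ^ᴳ i                      ≈⟨ h^i≈h^j ⟩
        h ^ᴳ j                      ≡⟨ cong (h ^ᴳ_) (m+[n∸m]≡n (<⇒≤ i<j)) ⟨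
        h ^ᴳ (i + (j ∸ i))          ≈⟨ ^ᴳ-homo-+ h i (j ∸ i) ⟩
        h ^ᴳ i ∙ h ^ᴳ (j ∸ i)       ∎)))

    ∈-powers⁺ : ∀ {y} k → y ≈ h ^ᴳ k → y ∈ᴳ powers h m
    ∈-powers⁺ k y≈h^k = Anyₚ.applyUpTo⁺ (h ^ᴳ_) (≈-trans y≈h^k (^ᴳ-%-order k)) (m%n<n k m)

    ∈-powers⁻ : ∀ {y} → y ∈ᴳ powers h m → ∃[ k ] k < m × y ≈ h ^ᴳ k
    ∈-powers⁻ = Anyₚ.applyUpTo⁻ (h ^ᴳ_)

    powers-∙ : ∀ {y z} → y ∈ᴳ powers h m → z ∈ᴳ powers h m → y ∙ z ∈ᴳ powers h m
    powers-∙ y∈ z∈ with i , _ , y≈h^i ← ∈-powers⁻ y∈ | j , _ , z≈h^j ← ∈-powers⁻ z∈ =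
      ∈-powers⁺ (i + j) (≈-trans (∙-cong y≈h^i z≈h^j) (≈-sym (^ᴳ-homo-+ h i j)))

    powers-⁻¹ : ∀ {y} → y ∈ᴳ powers h m → y ⁻¹ ∈ᴳ powers h m
    powers-⁻¹ y∈ with i , i<m , y≈h^i ← ∈-powers⁻ y∈ =
      ∈-powers⁺ (m ∸ i) (≈-trans (⁻¹-cong y≈h^i) (≈-sym (inverseʳ-unique _ _ h^i∙h^[m∸i]≈ε)))
      where
      h^i∙h^[m∸i]≈ε : h ^ᴳ i ∙ h ^ᴳ (m ∸ i) ≈ ε
      h^i∙h^[m∸i]≈ε = begin
        h ^ᴳ i ∙ h ^ᴳ (m ∸ i)   ≈⟨ ^ᴳ-homo-+ h i (m ∸ i) ⟨
        h ^ᴳ (i + (m ∸ i))      ≡⟨ cong (h ^ᴳ_) (m+[n∸m]≡n (<⇒≤ i<m)) ⟩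
        h ^ᴳ m                  ≈⟨ ^order≈ε ⟩
        ε                       ∎

-- Permutations of Fin n

-- π ∘ₚ ρ applies π first, so (π ∙ ρ) ⟨$⟩ʳ i reduces to ρ ⟨$⟩ʳ (π ⟨$⟩ʳ i).
Sym : ℕ → Group 0ℓ 0ℓ
Sym n = record
  { Carrier = Perm n
  ; _≈_     = _≈ₚ_
  ; _∙_     = _∘ₚ_
  ; ε       = id
  ; _⁻¹     = flip
  ; isGroup = record
    { isMonoid = record
      { isSemigroup = record
        { isMagma = record
          { isEquivalence = record
            { refl  = λ _ → refl
            ; sym   = λ π≈ρ i → sym (π≈ρ i)
            ; trans = λ π≈ρ ρ≈σ i → trans (π≈ρ i) (ρ≈σ i)
            }
          ; ∙-cong = λ {_} {_} {ρ} π≈π′ ρ≈ρ′ i → trans (cong (ρ ⟨$⟩ʳ_) (π≈π′ i)) (ρ≈ρ′ _)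
          }
        ; assoc = λ _ _ _ _ → refl
        }
      ; identity = (λ _ _ → refl) , (λ _ _ → refl)
      }
    ; inverse = (λ π _ → inverseʳ π) , (λ π _ → inverseˡ π)
    ; ⁻¹-cong = λ {π} {ρ} π≈ρ i →
        trans (cong (π ⟨$⟩ˡ_) (trans (sym (inverseʳ ρ)) (sym (π≈ρ _)))) (inverseˡ π)
    }
  }

module _ {n : ℕ} where

  open PowersInGroup (Sym n)

  ≈id? : ∀ (π : Perm n) → Dec (π ≈ₚ id)
  ≈id? π = all? λ i → π ⟨$⟩ʳ i ≟ i

  ⟨$⟩ʳ-injective : ∀ (π : Perm n) {i j} → π ⟨$⟩ʳ i ≡ π ⟨$⟩ʳ j → i ≡ j
  ⟨$⟩ʳ-injective π πi≡πj = trans (sym (inverseˡ π)) (trans (cong (π ⟨$⟩ˡ_) πi≡πj) (inverseˡ π))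

  ^ᴳ-fixes : ∀ {π i} → π ⟨$⟩ʳ i ≡ i → ∀ k → (π ^ᴳ k) ⟨$⟩ʳ i ≡ i
  ^ᴳ-fixes πi≡i zero          = refl
  ^ᴳ-fixes {π} πi≡i (suc k)   = trans (cong ((π ^ᴳ k) ⟨$⟩ʳ_) πi≡i) (^ᴳ-fixes πi≡i k)

  period : ∀ g i → ∃[ d ] 0 < d × d ≤ n × (g ^ᴳ d) ⟨$⟩ʳ i ≡ i
  period g i with a , b , a<b , g^ai≡g^bi ← pigeonhole (n<1+n n) (λ k → (g ^ᴳ toℕ k) ⟨$⟩ʳ i) =
    d , m<n⇒0<n∸m a<b , ≤-trans (m∸n≤m (toℕ b) (toℕ a)) (toℕ≤pred[n] b) ,
    ⟨$⟩ʳ-injective (g ^ᴳ toℕ a) (begin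
      (g ^ᴳ toℕ a) ⟨$⟩ʳ ((g ^ᴳ d) ⟨$⟩ʳ i)   ≡⟨ ^ᴳ-homo-+ g d (toℕ a) i ⟨
      (g ^ᴳ (d + toℕ a)) ⟨$⟩ʳ i              ≡⟨ cong (λ k → (g ^ᴳ k) ⟨$⟩ʳ i) (m∸n+n≡m (<⇒≤ a<b)) ⟩
      (g ^ᴳ toℕ b) ⟨$⟩ʳ i                    ≡⟨ g^ai≡g^bi ⟨
      (g ^ᴳ toℕ a) ⟨$⟩ʳ i                    ∎)
    where
    open ≡-Reasoning
    d : ℕ
    d = toℕ b ∸ toℕ a

  ^ᴳ-n!≈id : ∀ g → g ^ᴳ (n !) ≈ₚ id
  ^ᴳ-n!≈id g i with period g i
  ... | d , d>0 , d≤n , g^di≡i with ∣n! d>0 d≤n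
  ...   | divides c n!≡c*d = begin
    (g ^ᴳ (n !)) ⟨$⟩ʳ i      ≡⟨ cong (λ k → (g ^ᴳ k) ⟨$⟩ʳ i) n!≡c*d ⟩
    (g ^ᴳ (c * d)) ⟨$⟩ʳ i    ≡⟨ ^ᴳ-^ᴳ g d c i ⟨
    ((g ^ᴳ d) ^ᴳ c) ⟨$⟩ʳ i   ≡⟨ ^ᴳ-fixes g^di≡i c ⟩
    i                        ∎
    where open ≡-Reasoning

  stabilises-^ᴳ : ∀ {g Δ} → Stabilises g Δ → ∀ k → Stabilises (g ^ᴳ k) Δ
  stabilises-^ᴳ stab zero    i = refl
  stabilises-^ᴳ {g} {Δ} stab (suc k) i = trans (stabilises-^ᴳ {g} {Δ} stab k (g ⟨$⟩ʳ i)) (stab i)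

  stabilises-resp-≈ : ∀ {π ρ : Perm n} {Δ} → π ≈ₚ ρ → Stabilises π Δ → Stabilises ρ Δ
  stabilises-resp-≈ {Δ = Δ} π≈ρ stab i = trans (cong (lookup Δ) (sym (π≈ρ i))) (stab i)

  module _ {M : Perm n → Set} (M-group : IsPermGroup M) where

    open IsPermGroup M-group

    ^ᴳ∈ : ∀ {g} → M g → ∀ k → M (g ^ᴳ k)
    ^ᴳ∈ Mg zero    = id∈
    ^ᴳ∈ Mg (suc k) = ∘∈ Mg (^ᴳ∈ Mg k)

    cyclicSubgroup : ∀ {h p} → M h → Prime p → HasOrder h p → PrimeSubgroup M
    cyclicSubgroup {h} {p} Mh prime-p ord = record
      { elems    = powers h p
      ; distinct = powers-distinct ord
      ; prime    = subst Prime (sym (length-applyUpTo (h ^ᴳ_) p)) prime-p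
      ; ⊆M       = Allₚ.applyUpTo⁺₂ (h ^ᴳ_) p (^ᴳ∈ Mh)
      ; id∈      = ∈-powers⁺ ord {id} 0 (λ _ → refl)
      ; ∘∈       = λ {π} {σ} → powers-∙ ord {π} {σ}
      ; ⁻¹∈      = λ {π} → powers-⁻¹ ord {π}
      }

    primeSubgroupOf : ∀ {g} → M g → ¬ g ≈ₚ id →
                      Σ[ C ∈ PrimeSubgroup M ]
                        (∀ {y} → y ∈ₚ PrimeSubgroup.elems C → ∃[ k ] y ≈ₚ g ^ᴳ k)
    primeSubgroupOf {g} Mg g≉id with order ≈id? (1≤n! n) (^ᴳ-n!≈id g)
    ... | _ , ord with primeOrderPower ord g≉id
    ...   | p , q , prime-p , ord′ =
      cyclicSubgroup (^ᴳ∈ Mg q) prime-p ord′ ,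
      λ {y} y∈ → let k , _ , y≈[g^q]^k = ∈-powers⁻ ord′ {y} y∈ in
        k * q , λ i → trans (y≈[g^q]^k i) (^ᴳ-^ᴳ g q k i)

-- Orbits of a subgroup of prime order

module Orbits {n : ℕ} {M : Perm n → Set} (C : PrimeSubgroup M) where

  open PrimeSubgroup C

  orbit : Fin n → List (Fin n)
  orbit i = map (_⟨$⟩ʳ i) elems

  ∈-orbit⁺ : ∀ g {i} → g ∈ₚ elems → g ⟨$⟩ʳ i ∈ orbit i
  ∈-orbit⁺ g {i} g∈ = Anyₚ.map⁺ {f = _⟨$⟩ʳ i} (Any.map (λ g≈h → g≈h i) g∈)

  ∈-orbit⁻ : ∀ {i j} → j ∈ orbit i → ∃[ g ] g ∈ₚ elems × j ≡ g ⟨$⟩ʳ i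
  ∈-orbit⁻ j∈ with g , g∈ , j≡gi ← find (Anyₚ.map⁻ {f = _⟨$⟩ʳ _} j∈) =
    g , Any.map (λ { refl _ → refl }) g∈ , j≡gi

  i∈orbit[i] : ∀ i → i ∈ orbit i
  i∈orbit[i] i = ∈-orbit⁺ id id∈

  orbit-trans : ∀ {i j k} → j ∈ orbit i → k ∈ orbit j → k ∈ orbit i
  orbit-trans j∈ k∈ with ∈-orbit⁻ j∈
  ... | g , g∈ , refl with ∈-orbit⁻ k∈
  ...   | h , h∈ , refl = ∈-orbit⁺ (g ∘ₚ h) (∘∈ {g} {h} g∈ h∈)

  orbit-sym : ∀ {i j} → j ∈ orbit i → i ∈ orbit j
  orbit-sym j∈ with g , g∈ , refl ← ∈-orbit⁻ j∈ =
    subst (_∈ orbit _) (inverseˡ g) (∈-orbit⁺ (flip g) (⁻¹∈ {g} g∈))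

  IsLeast : Fin n → Set
  IsLeast i = All (λ g → toℕ i ≤ toℕ (g ⟨$⟩ʳ i)) elems

  isLeast? : Decidable IsLeast
  isLeast? i = All.all? (λ g → toℕ i ≤? toℕ (g ⟨$⟩ʳ i)) elems

  IsFixed : Fin n → Set
  IsFixed i = All (λ g → g ⟨$⟩ʳ i ≡ i) elems

  isFixed? : Decidable IsFixed
  isFixed? i = All.all? (λ g → g ⟨$⟩ʳ i ≟ i) elems

  -- orbC C and fixC C are, by definition, the lengths of leaders and fixedPoints.
  leaders nonLeaders fixedPoints : List (Fin n)
  leaders     = filter isLeast? (allFin n)
  nonLeaders  = filter (∁? isLeast?) (allFin n)
  fixedPoints = filter isFixed? (allFin n)

  least-≤ : ∀ {i j} → IsLeast i → j ∈ orbit i → toℕ i ≤ toℕ j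
  least-≤ least-i = All.lookup (Allₚ.map⁺ least-i)

  fixed⇒orbit≡ : ∀ {i j} → IsFixed i → j ∈ orbit i → j ≡ i
  fixed⇒orbit≡ fixed-i = All.lookup (Allₚ.map⁺ fixed-i)

  leasts-in-orbit-≡ : ∀ {i j} → IsLeast i → IsLeast j → j ∈ orbit i → i ≡ j
  leasts-in-orbit-≡ least-i least-j j∈ =
    toℕ-injective (≤-antisym (least-≤ least-i j∈) (least-≤ least-j (orbit-sym j∈)))

  minOrbit maxOrbit : Fin n → Fin n
  minOrbit i = argmin toℕ i (orbit i)
  maxOrbit i = argmax toℕ i (orbit i)

  self-or-∈orbit : ∀ {i j} → j ≡ i ⊎ j ∈ orbit i → j ∈ orbit i
  self-or-∈orbit (inj₁ refl) = i∈orbit[i] _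
  self-or-∈orbit (inj₂ j∈)   = j∈

  minOrbit∈orbit : ∀ i → minOrbit i ∈ orbit i
  minOrbit∈orbit i = self-or-∈orbit (argmin-sel toℕ i (orbit i))

  maxOrbit∈orbit : ∀ i → maxOrbit i ∈ orbit i
  maxOrbit∈orbit i = self-or-∈orbit (argmax-sel toℕ i (orbit i))

  minOrbit-isLeast : ∀ i → IsLeast (minOrbit i)
  minOrbit-isLeast i = Allₚ.map⁻ (All.tabulate λ j∈ →
    All.lookup (f[argmin]≤f[xs] {f = toℕ} i (orbit i)) (orbit-trans (minOrbit∈orbit i) j∈))

  ≤-maxOrbit : ∀ {i j} → j ∈ orbit i → toℕ j ≤ toℕ (maxOrbit i)
  ≤-maxOrbit {i} = All.lookup (f[xs]≤f[argmax] {f = toℕ} i (orbit i))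

  least-maxOrbit⇒fixed : ∀ {i} → IsLeast i → IsLeast (maxOrbit i) → IsFixed i
  least-maxOrbit⇒fixed {i} least-i least-max = Allₚ.map⁻ (All.tabulate λ {j} j∈ →
    toℕ-injective (≤-antisym (subst (λ k → toℕ j ≤ toℕ k) (sym i≡max) (≤-maxOrbit j∈))
                             (least-≤ least-i j∈)))
    where
    i≡max : i ≡ maxOrbit i
    i≡max = leasts-in-orbit-≡ least-i least-max (maxOrbit∈orbit i)

  leader⇒isLeast : ∀ {i} → i ∈ leaders → IsLeast i
  leader⇒isLeast i∈ = proj₂ (∈-filter⁻ isLeast? {xs = allFin n} i∈)

  maxOrbit-injective : ∀ {i j} → i ∈ leaders → j ∈ leaders → maxOrbit i ≡ maxOrbit j → i ≡ j
  maxOrbit-injective {i} {j} i∈ j∈ max[i]≡max[j] =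
    leasts-in-orbit-≡ (leader⇒isLeast i∈) (leader⇒isLeast j∈) (orbit-trans (maxOrbit∈orbit i) j∈orbit[max[i]])
    where
    j∈orbit[max[i]] : j ∈ orbit (maxOrbit i)
    j∈orbit[max[i]] = subst (λ k → j ∈ orbit k) (sym max[i]≡max[j]) (orbit-sym (maxOrbit∈orbit j))

  maxOrbit-into : ∀ {i} → i ∈ leaders → maxOrbit i ∈ fixedPoints ++ nonLeaders
  maxOrbit-into {i} i∈ with isFixed? i
  ... | yes fixed-i = ∈-++⁺ˡ (∈-filter⁺ isFixed? (∈-allFin _)
          (subst IsFixed (sym (fixed⇒orbit≡ fixed-i (maxOrbit∈orbit i))) fixed-i))
  ... | no ¬fixed-i = ∈-++⁺ʳ fixedPoints (∈-filter⁺ (∁? isLeast?) (∈-allFin _)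
          (¬fixed-i ∘ least-maxOrbit⇒fixed (leader⇒isLeast i∈)))

  2*orbC≤n+fixC : 2 * orbC C ≤ n + fixC C
  2*orbC≤n+fixC = 2*m≤n+o orbC≤fixC+#nonLeaders orbC+#nonLeaders≡n
    where
    orbC≤fixC+#nonLeaders : orbC C ≤ fixC C + length nonLeaders
    orbC≤fixC+#nonLeaders = ≤-trans
      (length≤-injection maxOrbit (Uniqueₚ.filter⁺ isLeast? (Uniqueₚ.allFin⁺ n))
                         maxOrbit-injective maxOrbit-into)
      (≤-reflexive (length-++ fixedPoints))
    orbC+#nonLeaders≡n : orbC C + length nonLeaders ≡ n
    orbC+#nonLeaders≡n =
      trans (length-filter+filter-∁ isLeast? (allFin n)) (length-tabulate (λ i → i))

  Invariant : Subset n → Set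
  Invariant Δ = ∀ y → y ∈ₚ elems → Stabilises y Δ

  invariant⇒constant-on-orbits : ∀ {Δ} → Invariant Δ →
                                 ∀ {i j} → j ∈ orbit i → lookup Δ j ≡ lookup Δ i
  invariant⇒constant-on-orbits invariant j∈ with g , g∈ , refl ← ∈-orbit⁻ j∈ = invariant g g∈ _

  invariantSubsets : List (Subset n)
  invariantSubsets = map (preimage minOrbit) (subsetsOf leaders)

  length-invariantSubsets : length invariantSubsets ≡ 2 ^ orbC C
  length-invariantSubsets =
    trans (length-map (preimage minOrbit) (subsetsOf leaders)) (length-subsetsOf leaders)

  ∈-invariantSubsets : ∀ {Δ} → Invariant Δ → Δ ∈ invariantSubsets
  ∈-invariantSubsets {Δ} invariant = ∈-preimages
    (λ i → ∈-filter⁺ isLeast? (∈-allFin _) (minOrbit-isLeast i))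
    (λ i → invariant⇒constant-on-orbits {Δ} invariant (minOrbit∈orbit i))

open Orbits
  using (Invariant; invariantSubsets; length-invariantSubsets; ∈-invariantSubsets; 2*orbC≤n+fixC)

module _ {n : ℕ} {M : Perm n → Set} (M-group : IsPermGroup M)
         {Cs : List (PrimeSubgroup M)} (enumerates : Enumerates𝓒 M Cs) where

  open PowersInGroup (Sym n) using (_^ᴳ_)

  F⊆invariantSubsets : ∀ {Δ} → InF M Δ → Δ ∈ concatMap invariantSubsets Cs
  F⊆invariantSubsets {Δ} (g , Mg , g≉id , stab) with primeSubgroupOf M-group Mg g≉id
  ... | C , C⊆⟨g⟩ with find (proj₂ enumerates C)
  ...   | C′ , C′∈Cs , C≡C′ =
    ∈-concat⁺′ (∈-invariantSubsets C′ invariant) (∈-map⁺ invariantSubsets C′∈Cs)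
    where
    invariant : Invariant C′ Δ
    invariant y y∈C′ with k , y≈g^k ← C⊆⟨g⟩ {y} (Equivalence.from (C≡C′ y) y∈C′) =
      stabilises-resp-≈ {π = g ^ᴳ k} {y} {Δ} (λ i → sym (y≈g^k i))
        (stabilises-^ᴳ {g = g} {Δ = Δ} stab k)

  cardF≤ : CardFLe M (sum (map (λ C → 2 ^ orbC C) Cs))
  cardF≤ Ds unique Ds⊆F = begin
    length Ds
      ≤⟨ length≤-injection (λ Δ → Δ) unique (λ _ _ Δ≡Δ′ → Δ≡Δ′) (F⊆invariantSubsets ∘ All.lookup Ds⊆F) ⟩
    length (concatMap invariantSubsets Cs)
      ≡⟨ length-concatMap invariantSubsets Cs ⟩
    sum (map (length ∘ invariantSubsets) Cs)
      ≡⟨ cong sum (map-cong length-invariantSubsets Cs) ⟩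
    sum (map (λ C → 2 ^ orbC C) Cs)
      ∎
    where open ≤-Reasoning

2*m≤n⇒m≤half : ∀ m n → 2 * m ≤ n → m ≤ half n
2*m≤n⇒m≤half zero    n _ = z≤n
2*m≤n⇒m≤half (suc m) n 2[1+m]≤n with n | subst (_≤ n) (*-suc 2 m) 2[1+m]≤n
... | suc (suc n′) | s≤s (s≤s 2m≤n′) = s≤s (2*m≤n⇒m≤half m n′ 2m≤n′)

evenPart+oddPart : ∀ ks → evenPart ks + oddPart ks ≡ sum (map (λ k → 2 ^ half k) ks)
evenPart+oddPart []       = refl
evenPart+oddPart (k ∷ ks) with isEven k
... | true  = trans (+-assoc (2 ^ half k) _ _) (cong (2 ^ half k +_) (evenPart+oddPart ks))
... | false =
  trans (x∙yz≈y∙xz (evenPart ks) (2 ^ half k) _) (cong (2 ^ half k +_) (evenPart+oddPart ks))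

-- Termwise 2^⌊k/2⌋ ≤ (√2)^k: A ≤ evenPart + oddPart ≤ evenPart + oddPart · √2.
Σ2^half≤Σ√2^ : ∀ {A} ks → A ≤ sum (map (λ k → 2 ^ half k) ks) → A ≤Σ√2^ ks
Σ2^half≤Σ√2^ {A} ks A≤Σ = ≤-trans (^-monoˡ-≤ 2 A∸evenPart≤oddPart) (m≤n*m (oddPart ks ^ 2) 2)
  where
  A∸evenPart≤oddPart : A ∸ evenPart ks ≤ oddPart ks
  A∸evenPart≤oddPart =
    m≤n+o⇒m∸n≤o A (evenPart ks) (≤-trans A≤Σ (≤-reflexive (sym (evenPart+oddPart ks))))

lemma4p3 : (n : ℕ) (M : Perm n → Set) → IsPermGroup M →
           (Cs : List (PrimeSubgroup M)) → Enumerates𝓒 M Cs →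
           CardFLe M (sum (map (λ C → 2 ^ orbC C) Cs))
           × (sum (map (λ C → 2 ^ orbC C) Cs) ≤Σ√2^ map (λ C → n + fixC C) Cs)
lemma4p3 n M M-group Cs enumerates =
  cardF≤ M-group enumerates , Σ2^half≤Σ√2^ (map (λ C → n + fixC C) Cs) (begin
    sum (map (λ C → 2 ^ orbC C) Cs)
      ≤⟨ sum-map-mono-≤ (λ C → ^-monoʳ-≤ 2 (2*m≤n⇒m≤half (orbC C) _ (2*orbC≤n+fixC C))) Cs ⟩
    sum (map (λ C → 2 ^ half (n + fixC C)) Cs)
      ≡⟨ cong sum (map-∘ Cs) ⟩
    sum (map (λ k → 2 ^ half k) (map (λ C → n + fixC C) Cs))
      ∎)
  where open ≤-Reasoning
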